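{- For all $n\ge 0$, \[ H_n\!\left(q,\frac{1}{1-q}\right)=\frac{1}{(1-q)^n}, \] where $H_n(q,t)=\sum_{k=0}^n S_q(n,k)\,t^k$.
   Context: The $q$-Stirling numbers $S_q(n,k)$ are defined for integers $n,k\ge 0$ by \[ S_q(n,k)=q^{k-1}S_q(n-1,k-1)+[k]_qS_q(n-1,k)\quad(n,k\ge1), \] and $S_q(n,k)=\delta_{n,k}$ if $n=0$ or $k=0$, where $[k]_q=1+q+\dots+q^{k-1}$ and $\delta_{n,k}$ is the Kronecker delta. Equivalently, $S_q(n,k)=\sum_A q^{\mathtt{i}(A)}$ over set partitions $A$ of $\{1,\dots,n\}$ with $k$ blocks, where $\mathtt{i}$ is the Ehrenborg–Readdy intertwining number. -}

module Defs where

open import Level using (Level)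
open import Data.Nat using (ℕ; zero; suc)
open import Algebra.Bundles using (CommutativeRing; Semiring)
import Algebra.Definitions.RawSemiring as RS

-- Everything is evaluated in an arbitrary commutative ring R at an element q.
module QStirling {c ℓ : Level} (R : CommutativeRing c ℓ) where
  open CommutativeRing R hiding (zero)
  open RS (Semiring.rawSemiring semiring) using (_^_) public

  [_]_ : ℕ → Carrier → Carrier
  [ zero ] q = 0#
  [ suc k ] q = 1# + q * [ k ] q

  S : Carrier → ℕ → ℕ → Carrier
  S q zero zero = 1#
  S q zero (suc k) = 0#
  S q (suc n) zero = 0#
  S q (suc n) (suc k) = (q ^ k) * S q n k + [ suc k ] q * S q n (suc k)

  sumTo : ℕ → (ℕ → Carrier) → Carrier
  sumTo zero f = f zero
  sumTo (suc m) f = sumTo m f + f (suc m)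

  H : ℕ → Carrier → Carrier → Carrier
  H n q t = sumTo n (λ k → S q n k * (t ^ k))

module Submission where

-- Write u for 1/(1-q), i.e. u(1-q) = 1, equivalently u = 1 + uq.
-- Then (1-q)[k]_q = 1 - q^k gives the key identity  [k]_q + u q^k = u.
-- Substituting it into the recurrence for S_q(n+1,k+1) and putting
-- a_k = q^k u^k S_q(n,k)  yields, for every j,
--   S_q(n+1,j+1) u^(j+1) + u a_(j+1) = u S_q(n,j+1) u^(j+1) + u a_j ,
-- so the terms of H_(n+1)(q,u) telescope against those of u H_n(q,u):
--   Σ_(k ≤ m) S_q(n+1,k) u^k + u a_m = u Σ_(k ≤ m) S_q(n,k) u^k .
-- At m = n+1 both a_(n+1) and S_q(n,n+1) vanish, giving H_(n+1) = u H_n,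
-- and induction on n finishes the proof.

open import Defs
open import Level using (Level)
open import Data.Nat using (ℕ; zero; suc; _<_; s≤s)
open import Data.Nat.Properties using (m<n⇒m<1+n; n<1+n)
open import Algebra.Bundles using (CommutativeRing)
import Algebra.Solver.Ring.NaturalCoefficients.Default as Solver
import Relation.Binary.Reasoning.Setoid as SetoidReasoning

module Proof {c ℓ : Level} (R : CommutativeRing c ℓ) where
  open CommutativeRing R
  open QStirling R
  open Solver commutativeSemiring using (solve; _:=_; _:+_; _:*_)
  open SetoidReasoning setoid

  sumTo-telescope : (f g h : ℕ → Carrier) →
    f 0 + g 0 ≈ h 0 →
    (∀ j → f (suc j) + g (suc j) ≈ h (suc j) + g j) →
    ∀ m → sumTo m f + g m ≈ sumTo m h
  sumTo-telescope f g h base step zero = base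
  sumTo-telescope f g h base step (suc m) = begin
      (sumTo m f + f (suc m)) + g (suc m)
    ≈⟨ +-assoc _ _ _ ⟩
      sumTo m f + (f (suc m) + g (suc m))
    ≈⟨ +-congˡ (step m) ⟩
      sumTo m f + (h (suc m) + g m)
    ≈⟨ solve 3 (λ F H G → F :+ (H :+ G) := (F :+ G) :+ H) refl (sumTo m f) (h (suc m)) (g m) ⟩
      (sumTo m f + g m) + h (suc m)
    ≈⟨ +-congʳ (sumTo-telescope f g h base step m) ⟩
      sumTo m h + h (suc m) ∎

  sumTo-*ˡ : (x : Carrier) (f : ℕ → Carrier) → ∀ m →
    sumTo m (λ k → x * f k) ≈ x * sumTo m f
  sumTo-*ˡ x f zero = refl
  sumTo-*ˡ x f (suc m) =
    trans (+-congʳ (sumTo-*ˡ x f m)) (sym (distribˡ x (sumTo m f) (f (suc m))))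

  -- S_q(n,k) = 0 above the diagonal: a partition of n elements has ≤ n blocks.
  S-vanish : (q : Carrier) (n k : ℕ) → n < k → S q n k ≈ 0#
  S-vanish q zero (suc k) _ = refl
  S-vanish q (suc n) (suc k) (s≤s n<k) = begin
      (q ^ k) * S q n k + [ suc k ] q * S q n (suc k)
    ≈⟨ +-cong (*-congˡ (S-vanish q n k n<k)) (*-congˡ (S-vanish q n (suc k) (m<n⇒m<1+n n<k))) ⟩
      (q ^ k) * 0# + [ suc k ] q * 0#
    ≈⟨ trans (+-cong (zeroʳ _) (zeroʳ _)) (+-identityˡ 0#) ⟩
      0# ∎

  H-extend : (q t : Carrier) (n : ℕ) →
    sumTo (suc n) (λ k → S q n k * t ^ k) ≈ H n q t
  H-extend q t n = begin
      H n q t + S q n (suc n) * t ^ suc n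
    ≈⟨ +-congˡ (*-congʳ (S-vanish q n (suc n) (n<1+n n))) ⟩
      H n q t + 0# * t ^ suc n
    ≈⟨ trans (+-congˡ (zeroˡ _)) (+-identityʳ _) ⟩
      H n q t ∎

  inverse⇒fixedPoint : (q u : Carrier) → u * (1# - q) ≈ 1# → u ≈ 1# + u * q
  inverse⇒fixedPoint q u h = begin
      u
    ≈⟨ sym (*-identityʳ u) ⟩
      u * 1#
    ≈⟨ *-congˡ (sym (trans (+-assoc 1# (- q) q) (trans (+-congˡ (-‿inverseˡ q)) (+-identityʳ 1#)))) ⟩
      u * ((1# - q) + q)
    ≈⟨ distribˡ u (1# - q) q ⟩
      u * (1# - q) + u * q
    ≈⟨ +-congʳ h ⟩
      1# + u * q ∎

  -- For such u, [k]_q + u q^k = u  (the identity [k]_q = (1 - q^k)/(1 - q)).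
  qInteger-fixedPoint : (q u : Carrier) → u ≈ 1# + u * q →
    ∀ k → [ k ] q + u * q ^ k ≈ u
  qInteger-fixedPoint q u fix zero = trans (+-identityˡ _) (*-identityʳ u)
  qInteger-fixedPoint q u fix (suc k) = begin
      (1# + q * [ k ] q) + u * (q * q ^ k)
    ≈⟨ solve 5 (λ e q K u P → (e :+ q :* K) :+ u :* (q :* P) := e :+ q :* (K :+ u :* P))
               refl 1# q ([ k ] q) u (q ^ k) ⟩
      1# + q * ([ k ] q + u * q ^ k)
    ≈⟨ +-congˡ (trans (*-congˡ (qInteger-fixedPoint q u fix k)) (*-comm q u)) ⟩
      1# + u * q
    ≈⟨ sym fix ⟩
      u ∎

  module Recursion (q u : Carrier) (fix : u ≈ 1# + u * q) (n : ℕ) where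

    correction : ℕ → Carrier
    correction k = (q ^ k) * (u ^ k) * S q n k

    -- One step of the recurrence, rewritten with [j+1]_q = u - u q^(j+1).
    S-step : ∀ j →
      S q (suc n) (suc j) * u ^ suc j + u * correction (suc j)
        ≈ u * (S q n (suc j) * u ^ suc j) + u * correction j
    S-step j = begin
        ((q ^ j) * S q n j + [ suc j ] q * S q n (suc j)) * (u * u ^ j)
          + u * ((q * q ^ j) * (u * u ^ j) * S q n (suc j))
      ≈⟨ solve 7 (λ Q S₀ S₁ U q u K →
                   (Q :* S₀ :+ K :* S₁) :* (u :* U) :+ u :* (q :* Q :* (u :* U) :* S₁)
                   := (K :+ u :* (q :* Q)) :* (S₁ :* (u :* U)) :+ u :* (Q :* U :* S₀))
                 refl (q ^ j) (S q n j) (S q n (suc j)) (u ^ j) q u ([ suc j ] q) ⟩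
        ([ suc j ] q + u * (q * q ^ j)) * (S q n (suc j) * (u * u ^ j))
          + u * ((q ^ j) * (u ^ j) * S q n j)
      ≈⟨ +-congʳ (*-congʳ (qInteger-fixedPoint q u fix (suc j))) ⟩
        u * (S q n (suc j) * u ^ suc j) + u * correction j ∎

    S-step₀ : S q (suc n) 0 * u ^ 0 + u * correction 0 ≈ u * (S q n 0 * u ^ 0)
    S-step₀ = begin
        0# * 1# + u * (1# * 1# * S q n 0)
      ≈⟨ +-cong (zeroˡ 1#) (*-congˡ (*-congʳ (*-identityˡ 1#))) ⟩
        0# + u * (1# * S q n 0)
      ≈⟨ +-identityˡ _ ⟩
        u * (1# * S q n 0)
      ≈⟨ *-congˡ (*-comm 1# (S q n 0)) ⟩
        u * (S q n 0 * 1#) ∎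

    H-recursion : H (suc n) q u ≈ u * H n q u
    H-recursion = begin
        H (suc n) q u
      ≈⟨ sym (+-identityʳ _) ⟩
        H (suc n) q u + 0#
      ≈⟨ +-congˡ (sym correction-vanishes) ⟩
        H (suc n) q u + u * correction (suc n)
      ≈⟨ sumTo-telescope _ (λ k → u * correction k) _ S-step₀ S-step (suc n) ⟩
        sumTo (suc n) (λ k → u * (S q n k * u ^ k))
      ≈⟨ sumTo-*ˡ u _ (suc n) ⟩
        u * sumTo (suc n) (λ k → S q n k * u ^ k)
      ≈⟨ *-congˡ (H-extend q u n) ⟩
        u * H n q u ∎
      where
        correction-vanishes : u * correction (suc n) ≈ 0#
        correction-vanishes = begin
            u * (q ^ suc n * u ^ suc n * S q n (suc n))
          ≈⟨ *-congˡ (*-congˡ (S-vanish q n (suc n) (n<1+n n))) ⟩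
            u * (q ^ suc n * u ^ suc n * 0#)
          ≈⟨ trans (*-congˡ (zeroʳ _)) (zeroʳ u) ⟩
            0# ∎

  H-at-inverse : (q u : Carrier) → u * (1# - q) ≈ 1# → ∀ n → H n q u ≈ u ^ n
  H-at-inverse q u h zero = *-identityˡ 1#
  H-at-inverse q u h (suc n) = begin
      H (suc n) q u
    ≈⟨ Recursion.H-recursion q u (inverse⇒fixedPoint q u h) n ⟩
      u * H n q u
    ≈⟨ *-congˡ (H-at-inverse q u h n) ⟩
      u * u ^ n ∎

mainTheorem6 : {c ℓ : Level} (R : CommutativeRing c ℓ) →
    let open CommutativeRing R
        open QStirling R
    in (q u : Carrier) → u * (1# - q) ≈ 1# → (n : ℕ) →
       H n q u ≈ u ^ n
mainTheorem6 R = Proof.H-at-inverse R
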